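{- Let $k\in\mathbb{N}$ and $n=2(2k+1)$. For $j\in[2k+1]$, say that $x\in\{0,1\}^n$ satisfies pattern $P_j$ if $x_{2j-1}=x_{2j}=1$ and, for every $i\in[k]$, $x_{2j+2i}=0$ and $x_{2j-2i-1}=x_{2j-2i}=0$, where all indices are taken modulo $n$ (in $\{1,\dots,n\}$). Define $g:\{0,1\}^n\to\{0,1\}$ by $g(x)=1$ if and only if $x$ satisfies $P_j$ for some $j\in[2k+1]$. Then $s_1(g)=3k+2$, $s_0(g)=1$, and $bs_0(g)=2k+1$.
   Context: For $g:\{0,1\}^n\to\{0,1\}$ and $x\in\{0,1\}^n$, $x^{(i)}$ denotes $x$ with its $i$-th bit flipped, and $x^{(B)}$ denotes $x$ with all bits indexed by $B\subseteq[n]$ flipped. The sensitivity at $x$ is $s(g,x)=|\{i: g(x^{(i)})\neq g(x)\}|$; $s_0(g)=\max_{x\in g^{ -1}(0)}s(g,x)$ and $s_1(g)=\max_{x\in g^{ -1}(1)}s(g,x)$. The block sensitivity $bs(g,x)$ is the maximum number $b$ of pairwise disjoint subsets $B_1,\dots,B_b\subseteq[n]$ with $g(x^{(B_i)})\neq g(x)$ for all $i$; $bs_0(g)=\max_{x\in g^{ -1}(0)}bs(g,x)$. -}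

module Defs where

open import Data.Nat using (ℕ; zero; suc; _+_; _*_; _∸_; _≤_; _%_)
open import Data.Nat.DivMod using (_mod_)
open import Data.Bool using (Bool; true; false; not; _xor_; if_then_else_)
open import Data.Fin using (Fin; _≟_)
open import Data.Fin.Subset using (Subset; _∈_; ∣_∣)
open import Data.Vec using (tabulate; lookup)
open import Data.Product using (Σ; ∃; _×_)
open import Data.Empty using (⊥)
open import Relation.Nullary using (¬_)
open import Relation.Nullary.Decidable using (⌊_⌋)
open import Relation.Binary.PropositionalEquality using (_≡_)

-- Inputs x ∈ {0,1}^n are functions Fin n → Bool (0 = false, 1 = true).
-- Coordinate i (1-based, i ∈ [n]) of the paper is Fin index i-1.
BoolFun : ℕ → Set
BoolFun n = (Fin n → Bool) → Bool

flipBit : ∀ {n} → (Fin n → Bool) → Fin n → (Fin n → Bool)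
flipBit x i j = if ⌊ j ≟ i ⌋ then not (x j) else x j

flipSet : ∀ {n} → (Fin n → Bool) → Subset n → (Fin n → Bool)
flipSet x B j = lookup B j xor x j

sens : ∀ {n} → BoolFun n → (Fin n → Bool) → ℕ
sens g x = ∣ tabulate (λ i → g (flipBit x i) xor g x) ∣

IsMax : (ℕ → Set) → ℕ → Set
IsMax S m = S m × (∀ m' → S m' → m' ≤ m)

IsSensB : ∀ {n} → Bool → BoolFun n → ℕ → Set
IsSensB b g = IsMax (λ v → Σ _ λ x → g x ≡ b × sens g x ≡ v)

HasBlocks : ∀ {n} → BoolFun n → (Fin n → Bool) → ℕ → Set
HasBlocks {n} g x c =
  Σ (Fin c → Subset n) λ B →
    (∀ i j → ¬ (i ≡ j) → ∀ l → l ∈ B i → l ∈ B j → ⊥) ×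
    (∀ i → ¬ (g (flipSet x (B i)) ≡ g x))

IsBlockSens : ∀ {n} → BoolFun n → (Fin n → Bool) → ℕ → Set
IsBlockSens g x = IsMax (HasBlocks g x)

IsBlockSens0 : ∀ {n} → BoolFun n → ℕ → Set
IsBlockSens0 g = IsMax (λ c → Σ _ λ x → g x ≡ false × IsBlockSens g x c)

N : ℕ → ℕ
N k = 2 * suc (2 * k)

at : (k : ℕ) → ℕ → Fin (N k)
at k p = (p ∸ 1) mod (N k)

-- x satisfies pattern P_j.  Negative indices 2j-2i-1, 2j-2i are shifted by +n
-- (same residue mod n; keeps them positive since 2i+1 ≤ 2k+1 < n).
Pattern : (k : ℕ) → (Fin (N k) → Bool) → ℕ → Set
Pattern k x j =
  x (at k (2 * j ∸ 1)) ≡ true × x (at k (2 * j)) ≡ true ×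
  (∀ i → 1 ≤ i → i ≤ k →
     x (at k (2 * j + 2 * i)) ≡ false ×
     x (at k (N k + 2 * j ∸ (2 * i + 1))) ≡ false ×
     x (at k (N k + 2 * j ∸ 2 * i)) ≡ false)

-- A pattern P_j is a rotation (by 2j positions) of one fixed template on the cycle of length
-- n = 4k+2: ones at the two lead offsets 0 and 1, zeros at the k odd offsets 3, 5, …, 2k+1 and
-- at the 2k offsets n-2k, …, n-1 preceding the lead, and k free offsets 2, 4, …, 2k.
--
-- s₁ = 3k+2: if x satisfies P_j, flipping a free bit keeps P_j, so only the 3k+2 constrained
-- bits can be sensitive; in the template itself every constrained flip is sensitive, because
-- the flipped input cannot satisfy any other P_j′ (that needs two more ones, at the leads of j′).
--
-- s₀ = 1: let g x = 0 and flip two different bits p, p′ to reach patterns j ≠ j′ (j = j′ would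
-- make x itself satisfy P_j). The second lead of each pattern lies at an odd offset, hence at a
-- zero, of the other pattern, so {p, p′} are exactly the two second leads. Then both first leads
-- are ones in both flipped inputs; they sit at even offsets 2d and 2d′ of each other with
-- d + d′ = 2k+1, so one of d, d′ exceeds k and that one is a forced zero.
--
-- bs₀ = 2k+1: disjoint sensitive blocks of a 0-input must reach distinct patterns (two blocks
-- reaching the same P_j would make x satisfy P_j), and the 2k+1 lead pairs of the all-zero input
-- are such blocks.

module Submission where

open import Defs
open import Data.Bool using (Bool; true; false; not; _xor_)
open import Data.Bool.Properties using (xor-comm; xor-identityʳ; not-¬; ¬-not; not-involutive)
open import Data.Empty using (⊥; ⊥-elim)
open import Data.Fin using (Fin; toℕ; fromℕ<; _≟_)
import Data.Fin as Fin
open import Data.Fin.Permutation using (Permutation; permutation; _⟨$⟩ʳ_)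
open import Data.Fin.Properties using (toℕ-fromℕ<; toℕ-injective; toℕ<n; pigeonhole)
open import Data.Fin.Subset using (Subset; _∈_; ⁅_⁆; ∣_∣; _⊆_)
open import Data.Fin.Subset.Properties
  using (p⊆q⇒∣p∣≤∣q∣; ∣⁅x⁆∣≡1; ∣⊥∣≡0; x∈⁅x⁆; x∈⁅y⁆⇒x≡y; nonempty?; Empty-unique)
open import Data.Maybe using (Maybe; just; nothing; is-just; fromMaybe)
open import Data.Nat using (ℕ; zero; suc; _+_; _*_; _∸_; _≤_; _<_; _%_; NonZero; z≤n; s≤s; _≤?_; _<?_)
open import Data.Nat.DivMod using (_mod_; %-distribˡ-+; m%n%n≡m%n; [m+n]%n≡m%n; m<n⇒m%n≡m)
open import Data.Nat.Properties hiding (_≟_)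
open import Data.Nat.Tactic.RingSolver using (solve-∀)
open import Data.Product using (Σ; ∃; _×_; _,_; proj₁; proj₂)
open import Data.Sum using (_⊎_; inj₁; inj₂; [_,_])
open import Data.Unit using (⊤; tt)
open import Data.Vec using (tabulate; lookup)
open import Data.Vec.Properties using (lookup∘tabulate; []=⇒lookup; lookup⇒[]=; tabulate-cong)
open import Function using (_∘_)
open import Function.Bundles using (_⇔_; Equivalence; mk⇔)
open import Function.Properties.Equivalence using () renaming (trans to ⇔-trans)
open import Relation.Binary.Definitions using (tri<; tri≈; tri>)
open import Relation.Binary.PropositionalEquality
  using (_≡_; _≢_; refl; sym; trans; cong; cong₂; subst; module ≡-Reasoning)
open import Relation.Nullary using (¬_; yes; no; contradiction)

open import Algebra.Properties.CommutativeMonoid.Sum +-0-commutativeMonoid using (sum; sum-permute)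

fromBool : Bool → ℕ
fromBool true  = 1
fromBool false = 0

module _ {n : ℕ} where

  ∈-tabulate⁺ : ∀ {f : Fin n → Bool} {i} → f i ≡ true → i ∈ tabulate f
  ∈-tabulate⁺ {f} {i} fi = lookup⇒[]= i (tabulate f) (trans (lookup∘tabulate f i) fi)

  ∈-tabulate⁻ : ∀ {f : Fin n → Bool} {i} → i ∈ tabulate f → f i ≡ true
  ∈-tabulate⁻ {f} {i} i∈ = trans (sym (lookup∘tabulate f i)) ([]=⇒lookup i∈)

  ∣tabulate∣-mono-≤ : ∀ {f h : Fin n → Bool} → (∀ i → f i ≡ true → h i ≡ true) →
                      ∣ tabulate f ∣ ≤ ∣ tabulate h ∣
  ∣tabulate∣-mono-≤ f⇒h = p⊆q⇒∣p∣≤∣q∣ (∈-tabulate⁺ ∘ f⇒h _ ∘ ∈-tabulate⁻)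

  ∣tabulate∣≤1 : ∀ {f : Fin n → Bool} → (∀ i j → f i ≡ true → f j ≡ true → i ≡ j) →
                 ∣ tabulate f ∣ ≤ 1
  ∣tabulate∣≤1 {f} unique with nonempty? (tabulate f)
  ... | yes (i , i∈) = subst (∣ tabulate f ∣ ≤_) (∣⁅x⁆∣≡1 i) (p⊆q⇒∣p∣≤∣q∣ ⊆⁅i⁆)
    where
    ⊆⁅i⁆ : tabulate f ⊆ ⁅ i ⁆
    ⊆⁅i⁆ j∈ = subst (_∈ ⁅ i ⁆) (unique i _ (∈-tabulate⁻ i∈) (∈-tabulate⁻ j∈)) (x∈⁅x⁆ i)
  ... | no empty = subst (_≤ 1) (sym (trans (cong ∣_∣ (Empty-unique empty)) (∣⊥∣≡0 n))) z≤n

  ∣tabulate∣≡1 : ∀ {f : Fin n → Bool} i → f i ≡ true → (∀ i j → f i ≡ true → f j ≡ true → i ≡ j) →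
                 ∣ tabulate f ∣ ≡ 1
  ∣tabulate∣≡1 {f} i fi unique = ≤-antisym (∣tabulate∣≤1 unique)
    (subst (_≤ ∣ tabulate f ∣) (∣⁅x⁆∣≡1 i)
      (p⊆q⇒∣p∣≤∣q∣ λ j∈ → subst (_∈ tabulate f) (sym (x∈⁅y⁆⇒x≡y i j∈)) (∈-tabulate⁺ fi)))

∣tabulate∣≡sum : ∀ {n} (f : Fin n → Bool) → ∣ tabulate f ∣ ≡ sum (fromBool ∘ f)
∣tabulate∣≡sum {zero}  f = refl
∣tabulate∣≡sum {suc n} f with f Fin.zero
... | true  = cong suc (∣tabulate∣≡sum (f ∘ Fin.suc))
... | false = ∣tabulate∣≡sum (f ∘ Fin.suc)

∣tabulate∘permute∣ : ∀ {n} (f : Fin n → Bool) (π : Permutation n n) →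
                     ∣ tabulate (f ∘ (π ⟨$⟩ʳ_)) ∣ ≡ ∣ tabulate f ∣
∣tabulate∘permute∣ f π = begin
  ∣ tabulate (f ∘ (π ⟨$⟩ʳ_)) ∣   ≡⟨ ∣tabulate∣≡sum (f ∘ (π ⟨$⟩ʳ_)) ⟩
  sum (fromBool ∘ f ∘ (π ⟨$⟩ʳ_)) ≡⟨ sum-permute (fromBool ∘ f) π ⟨
  sum (fromBool ∘ f)             ≡⟨ ∣tabulate∣≡sum f ⟨
  ∣ tabulate f ∣                 ∎
  where open ≡-Reasoning

sum-ones : ∀ u → sum {u} (λ _ → 1) ≡ u
sum-ones zero    = refl
sum-ones (suc u) = cong suc (sum-ones u)

module _ {n} (x : Fin n → Bool) where

  flipBit-self : ∀ i → flipBit x i i ≡ not (x i)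
  flipBit-self i with i ≟ i
  ... | yes _   = refl
  ... | no  i≢i = contradiction refl i≢i

  flipBit-other : ∀ {i j} → j ≢ i → flipBit x i j ≡ x j
  flipBit-other {i} {j} j≢i with j ≟ i
  ... | yes j≡i = contradiction j≡i j≢i
  ... | no  _   = refl

  flipBit-involutive : ∀ i j → flipBit (flipBit x i) i j ≡ x j
  flipBit-involutive i j with j ≟ i
  ... | yes refl = not-involutive (x j)
  ... | no  _    = refl

  flipBit-true : ∀ {i j} → x j ≡ false → flipBit x i j ≡ true → j ≡ i
  flipBit-true {i} {j} xj≡false flip≡true with j ≟ i
  ... | yes j≡i = j≡i
  ... | no  _   = contradiction (trans (sym xj≡false) flip≡true) λ ()

  flipBit-differs : ∀ {i i′ j} → flipBit x i j ≢ flipBit x i′ j → j ≡ i ⊎ j ≡ i′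
  flipBit-differs {i} {i′} {j} differ with j ≟ i | j ≟ i′
  ... | yes j≡i | _        = inj₁ j≡i
  ... | no  _   | yes j≡i′ = inj₂ j≡i′
  ... | no  _   | no  _    = contradiction refl differ

  flipBit-either : ∀ {i i′} → i ≢ i′ → ∀ j → x j ≡ flipBit x i j ⊎ x j ≡ flipBit x i′ j
  flipBit-either {i} {i′} i≢i′ j with j ≟ i
  ... | yes refl = inj₂ (sym (flipBit-other i≢i′))
  ... | no  _    = inj₁ refl

-- Rotations of Fin n

[m%n+o]%n≡[m+o]%n : ∀ m n o .{{_ : NonZero n}} → (m % n + o) % n ≡ (m + o) % n
[m%n+o]%n≡[m+o]%n m n o = begin
  (m % n + o) % n         ≡⟨ %-distribˡ-+ (m % n) o n ⟩
  (m % n % n + o % n) % n ≡⟨ cong (λ t → (t + o % n) % n) (m%n%n≡m%n m n) ⟩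
  (m % n + o % n) % n     ≡⟨ %-distribˡ-+ m o n ⟨
  (m + o) % n             ∎
  where open ≡-Reasoning

module Rotation (n : ℕ) .{{_ : NonZero n}} where

  infixl 6 _⊕_

  -- Opaque: letting the type checker unfold `_mod_` on symbolic arguments is ruinously slow.
  opaque
    _⊕_ : Fin n → ℕ → Fin n
    p ⊕ d = (toℕ p + d) mod n

    toℕ-⊕ : ∀ p d → toℕ (p ⊕ d) ≡ (toℕ p + d) % n
    toℕ-⊕ p d = toℕ-fromℕ< _

  toℕ-⊕-< : ∀ p d → toℕ p + d < n → toℕ (p ⊕ d) ≡ toℕ p + d
  toℕ-⊕-< p d lt = trans (toℕ-⊕ p d) (m<n⇒m%n≡m lt)

  ⊕-assoc : ∀ p d e → p ⊕ d ⊕ e ≡ p ⊕ (d + e)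
  ⊕-assoc p d e = toℕ-injective (begin
    toℕ (p ⊕ d ⊕ e)           ≡⟨ toℕ-⊕ (p ⊕ d) e ⟩
    (toℕ (p ⊕ d) + e) % n     ≡⟨ cong (λ t → (t + e) % n) (toℕ-⊕ p d) ⟩
    ((toℕ p + d) % n + e) % n ≡⟨ [m%n+o]%n≡[m+o]%n (toℕ p + d) n e ⟩
    (toℕ p + d + e) % n       ≡⟨ cong (_% n) (+-assoc (toℕ p) d e) ⟩
    (toℕ p + (d + e)) % n     ≡⟨ toℕ-⊕ p (d + e) ⟨
    toℕ (p ⊕ (d + e))         ∎)
    where open ≡-Reasoning

  ⊕-cong-% : ∀ p {d e} → d % n ≡ e % n → p ⊕ d ≡ p ⊕ e
  ⊕-cong-% p {d} {e} d≡e = toℕ-injective (begin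
    toℕ (p ⊕ d)             ≡⟨ toℕ-⊕ p d ⟩
    (toℕ p + d) % n         ≡⟨ %-distribˡ-+ (toℕ p) d n ⟩
    (toℕ p % n + d % n) % n ≡⟨ cong (λ w → (toℕ p % n + w) % n) d≡e ⟩
    (toℕ p % n + e % n) % n ≡⟨ %-distribˡ-+ (toℕ p) e n ⟨
    (toℕ p + e) % n         ≡⟨ toℕ-⊕ p e ⟨
    toℕ (p ⊕ e)             ∎)
    where open ≡-Reasoning

  ⊕-period : ∀ p → p ⊕ n ≡ p
  ⊕-period p = toℕ-injective (trans (toℕ-⊕ p n) (trans ([m+n]%n≡m%n (toℕ p) n) (m<n⇒m%n≡m (toℕ<n p))))

  ⊕-inverse : ∀ {d e} → d + e ≡ n → ∀ p → p ⊕ d ⊕ e ≡ p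
  ⊕-inverse d+e≡n p = trans (⊕-assoc p _ _) (trans (cong (p ⊕_) d+e≡n) (⊕-period p))

  ⊕-cancelʳ : ∀ {p q d} → d ≤ n → p ⊕ d ≡ q ⊕ d → p ≡ q
  ⊕-cancelʳ {p} {q} {d} d≤n eq = begin
    p                 ≡⟨ ⊕-inverse (m+[n∸m]≡n d≤n) p ⟨
    p ⊕ d ⊕ (n ∸ d)   ≡⟨ cong (_⊕ (n ∸ d)) eq ⟩
    q ⊕ d ⊕ (n ∸ d)   ≡⟨ ⊕-inverse (m+[n∸m]≡n d≤n) q ⟩
    q                 ∎
    where open ≡-Reasoning

  rotation : ∀ {d} → d ≤ n → Permutation n n
  rotation {d} d≤n = permutation (_⊕ d) (_⊕ (n ∸ d)) (⊕-inverse (m∸n+n≡m d≤n)) (⊕-inverse (m+[n∸m]≡n d≤n))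

data EvenOdd : ℕ → Set where
  even : ∀ h → EvenOdd (2 * h)
  odd  : ∀ h → EvenOdd (suc (2 * h))

evenOdd : ∀ n → EvenOdd n
evenOdd zero = even 0
evenOdd (suc n) with evenOdd n
... | even h = odd h
... | odd h  = subst EvenOdd (*-suc 2 h) (even (suc h))

half-≤ : ∀ {i k} → 2 * i ≤ suc (2 * k) → i ≤ k
half-≤ {i} {k} 2i≤1+2k =
  ≤-pred (*-cancelˡ-< 2 i (suc k) (subst (suc (2 * i) ≤_) (sym (*-suc 2 k)) (s≤s 2i≤1+2k)))

parity-cancel : ∀ {a b c d} → a ≤ 1 → b ≤ 1 → a + 2 * c ≡ b + 2 * d → a ≡ b × c ≡ d
parity-cancel {zero}        {zero}                _ _ eq = refl , *-cancelˡ-≡ _ _ 2 eq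
parity-cancel {suc zero}    {suc zero}            _ _ eq = refl , *-cancelˡ-≡ _ _ 2 (suc-injective eq)
parity-cancel {zero}        {suc zero}    {c} {d} _ _ eq = contradiction eq (even≢odd c d)
parity-cancel {suc zero}    {zero}        {c} {d} _ _ eq = contradiction (sym eq) (even≢odd d c)
parity-cancel {suc (suc _)} {_}                   (s≤s ()) _
parity-cancel {_}           {suc (suc _)}         _ (s≤s ())

≤-of-sum : ∀ {i j t} → i + j ≡ suc t → 1 ≤ j → i ≤ t
≤-of-sum {i} {j} {t} i+j≡1+t 1≤j =
  ≤-pred (subst (suc i ≤_) i+j≡1+t (subst (_≤ i + j) (+-comm i 1) (+-monoʳ-≤ i 1≤j)))

N≡2k+2+2k : ∀ k → 2 * suc (2 * k) ≡ 2 * k + 2 + 2 * k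
N≡2k+2+2k = solve-∀

N∸[2k+2]≡2k : ∀ k → N k ∸ (2 * k + 2) ≡ 2 * k
N∸[2k+2]≡2k k = trans (cong (_∸ (2 * k + 2)) (N≡2k+2+2k k)) (m+n∸m≡n (2 * k + 2) (2 * k))

N∸2k≡2k+2 : ∀ k → N k ∸ 2 * k ≡ 2 * k + 2
N∸2k≡2k+2 k = trans (cong (_∸ (2 * k)) (N≡2k+2+2k k)) (m+n∸n≡m (2 * k + 2) (2 * k))

module _ {k : ℕ} where

  2i≤N : ∀ {i} → i ≤ k → 2 * i ≤ N k
  2i≤N i≤k = *-monoʳ-≤ 2 (≤-trans i≤k (≤-trans (m≤m+n k (k + 0)) (n≤1+n _)))

  1+2i<N : ∀ {i} → i ≤ k → suc (2 * i) < N k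
  1+2i<N {i} i≤k = subst (_≤ N k) (*-suc 2 i) (*-monoʳ-≤ 2 (s≤s (≤-trans i≤k (m≤m+n k (k + 0)))))

  1+4k<N : 1 + 2 * (2 * k) < N k
  1+4k<N = ≤-reflexive (2+4k≡N k)
    where
    2+4k≡N : ∀ k → 2 + 2 * (2 * k) ≡ 2 * suc (2 * k)
    2+4k≡N = solve-∀

  N∸2i<N : ∀ {i} → 1 ≤ i → i ≤ k → N k ∸ 2 * i < N k
  N∸2i<N {suc i} _ i≤k = ∸-monoʳ-< {o = 0} (subst (0 <_) (sym (*-suc 2 i)) (s≤s z≤n)) (2i≤N i≤k)

  1+N∸2i<N : ∀ {i} → 1 ≤ i → i ≤ k → suc (N k) ∸ 2 * i < N k
  1+N∸2i<N {suc i} _ i≤k = subst (λ w → suc (N k) ∸ w < N k) (sym (*-suc 2 i))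
    (∸-monoʳ-< {o = 0} (s≤s z≤n) (≤-trans (n≤1+n _) (subst (_≤ N k) (*-suc 2 i) (2i≤N i≤k))))

  2k+2≤N∸2i : ∀ {i} → i ≤ k → 2 * k + 2 ≤ N k ∸ 2 * i
  2k+2≤N∸2i {i} i≤k = subst (_≤ N k ∸ 2 * i) (N∸2k≡2k+2 k) (∸-monoʳ-≤ (N k) (*-monoʳ-≤ 2 i≤k))

record Distance (k a b : ℕ) : Set where
  field
    forward backward : ℕ
    1≤forward        : 1 ≤ forward
    1≤backward       : 1 ≤ backward
    forward+backward : forward + backward ≡ suc (2 * k)
    forward-shift    : 2 * forward + 2 * a ≡ 2 * b
    backward-shift   : 2 * backward + 2 * b ≡ 2 * a + N k

distance : ∀ {k a b} → a < b → b < suc (2 * k) → Distance k a b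
distance {k} {a} a<b b<m with d , refl ← m≤n⇒∃[o]m+o≡n a<b | e , b+e≡m ← m≤n⇒∃[o]m+o≡n b<m = record
  { forward          = suc d
  ; backward         = a + suc e
  ; 1≤forward        = s≤s z≤n
  ; 1≤backward       = ≤-trans (s≤s z≤n) (m≤n+m (suc e) a)
  ; forward+backward = trans (sum-eq a d e) b+e≡m
  ; forward-shift    = forward-eq a d
  ; backward-shift   = trans (backward-eq a d e) (cong (λ w → 2 * a + 2 * w) b+e≡m)
  }
  where
  sum-eq : ∀ a d e → suc d + (a + suc e) ≡ suc (suc a + d) + e
  sum-eq = solve-∀
  forward-eq : ∀ a d → 2 * suc d + 2 * a ≡ 2 * (suc a + d)
  forward-eq = solve-∀
  backward-eq : ∀ a d e → 2 * (a + suc e) + 2 * (suc a + d) ≡ 2 * a + 2 * (suc (suc a + d) + e)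
  backward-eq = solve-∀

-- The template of a pattern

-- role k r is the value forced on the position at offset r (0-based, counted from x_{2j-1}) by
-- a pattern P_j, or nothing if it is free. Offsets 0, 1 are x_{2j-1}, x_{2j}; offset 2i+1 is
-- x_{2j+2i}; the offsets n-2i and n-2i+1 (all ≥ 2k+2) are x_{2j-2i-1} and x_{2j-2i}.
tailRole : ℕ → ℕ → Maybe Bool
tailRole zero    _             = just false
tailRole (suc k) zero          = nothing
tailRole (suc k) (suc zero)    = just false
tailRole (suc k) (suc (suc s)) = tailRole k s

role : ℕ → ℕ → Maybe Bool
role k zero          = just true
role k (suc zero)    = just true
role k (suc (suc s)) = tailRole k s

tailRole-odd : ∀ k h → tailRole k (suc (2 * h)) ≡ just false
tailRole-odd zero    h       = refl
tailRole-odd (suc k) zero    = refl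
tailRole-odd (suc k) (suc h) =
  subst (λ s → tailRole (suc k) (suc s) ≡ just false) (sym (*-suc 2 h)) (tailRole-odd k h)

tailRole-even : ∀ {k} h → h < k → tailRole k (2 * h) ≡ nothing
tailRole-even {suc k} zero    _         = refl
tailRole-even {suc k} (suc h) (s≤s h<k) =
  subst (λ s → tailRole (suc k) s ≡ nothing) (sym (*-suc 2 h)) (tailRole-even h h<k)

tailRole-≥ : ∀ k s → 2 * k ≤ s → tailRole k s ≡ just false
tailRole-≥ zero    s _ = refl
tailRole-≥ (suc k) s 2k+2≤s with s | subst (_≤ s) (*-suc 2 k) 2k+2≤s
... | suc (suc s) | s≤s (s≤s 2k≤s) = tailRole-≥ k s 2k≤s

fromMaybe-tailRole : ∀ k s → fromMaybe false (tailRole k s) ≡ false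
fromMaybe-tailRole zero    s             = refl
fromMaybe-tailRole (suc k) zero          = refl
fromMaybe-tailRole (suc k) (suc zero)    = refl
fromMaybe-tailRole (suc k) (suc (suc s)) = fromMaybe-tailRole k s

role-odd : ∀ k {i} → 1 ≤ i → role k (suc (2 * i)) ≡ just false
role-odd k {suc i} _ = subst (λ r → role k (suc r) ≡ just false) (sym (*-suc 2 i)) (tailRole-odd k i)

role-even : ∀ {k i} → 1 ≤ i → i ≤ k → role k (2 * i) ≡ nothing
role-even {k} {suc i} _ i≤k = subst (λ r → role k r ≡ nothing) (sym (*-suc 2 i)) (tailRole-even i i≤k)

role-≥ : ∀ k r → 2 * k + 2 ≤ r → role k r ≡ just false
role-≥ k (suc (suc s)) 2k+2≤r =
  tailRole-≥ k s (≤-pred (≤-pred (subst (_≤ suc (suc s)) (+-comm (2 * k) 2) 2k+2≤r)))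
role-≥ k zero       2k+2≤r with () ← subst (_≤ 0) (+-comm (2 * k) 2) 2k+2≤r
role-≥ k (suc zero) 2k+2≤r with s≤s () ← subst (_≤ 1) (+-comm (2 * k) 2) 2k+2≤r

role-left₁ : ∀ {k i} → i ≤ k → role k (N k ∸ 2 * i) ≡ just false
role-left₁ {k} i≤k = role-≥ k _ (2k+2≤N∸2i i≤k)

role-left₂ : ∀ {k i} → i ≤ k → role k (suc (N k) ∸ 2 * i) ≡ just false
role-left₂ {k} {i} i≤k = role-≥ k _ (≤-trans (2k+2≤N∸2i i≤k) (∸-monoˡ-≤ (2 * i) (n≤1+n (N k))))

fromMaybe-role≡true⇒≤1 : ∀ k r → fromMaybe false (role k r) ≡ true → r ≤ 1
fromMaybe-role≡true⇒≤1 k zero          _  = z≤n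
fromMaybe-role≡true⇒≤1 k (suc zero)    _  = s≤s z≤n
fromMaybe-role≡true⇒≤1 k (suc (suc s)) eq with () ← trans (sym eq) (fromMaybe-tailRole k s)

constrainedBelow : (ℕ → Maybe Bool) → ℕ → ℕ
constrainedBelow ρ u = sum {u} (fromBool ∘ is-just ∘ ρ ∘ toℕ)

constrainedBelow-tailRole : ∀ k u → constrainedBelow (tailRole k) (2 * k + u) ≡ k + u
constrainedBelow-tailRole zero    u = sum-ones u
constrainedBelow-tailRole (suc k) u =
  subst (λ w → constrainedBelow (tailRole (suc k)) w ≡ suc k + u) (sym (2[1+k]+u k u))
    (cong suc (constrainedBelow-tailRole k u))
  where
  2[1+k]+u : ∀ k u → 2 * suc k + u ≡ suc (suc (2 * k + u))
  2[1+k]+u = solve-∀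

constrainedBelow-role : ∀ k → constrainedBelow (role k) (N k) ≡ 3 * k + 2
constrainedBelow-role k =
  subst (λ w → constrainedBelow (role k) w ≡ 3 * k + 2) (sym (N≡2+4k k))
    (trans (cong (2 +_) (constrainedBelow-tailRole k (2 * k))) (2+[k+2k] k))
  where
  N≡2+4k : ∀ k → 2 * suc (2 * k) ≡ suc (suc (2 * k + 2 * k))
  N≡2+4k = solve-∀
  2+[k+2k] : ∀ k → 2 + (k + 2 * k) ≡ 3 * k + 2
  2+[k+2k] = solve-∀

data Offset (k : ℕ) : ℕ → Set where
  lead₁ : Offset k 0
  lead₂ : Offset k 1
  gap   : ∀ {i} → 1 ≤ i → i ≤ k → Offset k (2 * i)
  right : ∀ {i} → 1 ≤ i → i ≤ k → Offset k (suc (2 * i))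
  left₁ : ∀ {i} → 1 ≤ i → i ≤ k → Offset k (N k ∸ 2 * i)
  left₂ : ∀ {i} → 1 ≤ i → i ≤ k → Offset k (suc (N k) ∸ 2 * i)

offset-view : ∀ k {r} → r < N k → Offset k r
offset-view k {zero}            _   = lead₁
offset-view k {suc zero}        _   = lead₂
offset-view k {r@(suc (suc _))} r<N with r ≤? suc (2 * k)
... | yes r≤1+2k = low (s≤s (s≤s z≤n)) r≤1+2k (evenOdd r)
  where
  low : ∀ {r} → 2 ≤ r → r ≤ suc (2 * k) → EvenOdd r → Offset k r
  low 2≤2i   2i≤1+2k   (even i)      = gap (*-cancelˡ-≤ {1} {i} 2 2≤2i) (half-≤ 2i≤1+2k)
  low 2≤1+2i _         (odd zero)    with s≤s () ← 2≤1+2i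
  low _      1+2i≤1+2k (odd (suc i)) = right (s≤s z≤n) (half-≤ (≤-trans (n≤1+n _) 1+2i≤1+2k))
... | no r≰1+2k = high (m∸n+n≡m (<⇒≤ r<N)) (m<n⇒0<n∸m r<N) N∸r≤2k (evenOdd (N k ∸ r))
  where
  N∸r≤2k : N k ∸ r ≤ 2 * k
  N∸r≤2k = ≤-trans (∸-monoʳ-≤ (N k) (subst (_≤ r) (+-comm 2 (2 * k)) (≰⇒> r≰1+2k)))
                   (≤-reflexive (N∸[2k+2]≡2k k))
  high : ∀ {r t} → t + r ≡ N k → 1 ≤ t → t ≤ 2 * k → EvenOdd t → Offset k r
  high {r} _      () _     (even zero)
  high {r} 2i+r≡N _  2i≤2k (even i@(suc _)) =
    subst (Offset k) (trans (cong (_∸ 2 * i) (sym 2i+r≡N)) (m+n∸m≡n (2 * i) r))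
      (left₁ (s≤s z≤n) (*-cancelˡ-≤ 2 2i≤2k))
  high {r} 1+2i+r≡N _ 1+2i≤2k (odd i) =
    subst (Offset k) (begin
      suc (N k) ∸ 2 * suc i               ≡⟨ cong₂ (λ w v → suc w ∸ v) (sym 1+2i+r≡N) (*-suc 2 i) ⟩
      suc (suc (2 * i) + r) ∸ (2 + 2 * i) ≡⟨ m+n∸m≡n (2 * i) r ⟩
      r                                   ∎)
      (left₂ (s≤s z≤n) (*-cancelˡ-< 2 i k 1+2i≤2k))
    where open ≡-Reasoning

-- The 1-based indices that `Pattern` uses for P_{J+1}, converted to 0-based positions
-- offset + 2J (before reduction modulo n).

index-lead₁ : ∀ J → 2 * suc J ∸ 1 ∸ 1 ≡ 0 + 2 * J
index-lead₁ J = cong (λ w → w ∸ 1 ∸ 1) (*-suc 2 J)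

index-lead₂ : ∀ J → 2 * suc J ∸ 1 ≡ 1 + 2 * J
index-lead₂ J = cong (_∸ 1) (*-suc 2 J)

index-right : ∀ J i → 2 * suc J + 2 * i ∸ 1 ≡ suc (2 * i) + 2 * J
index-right J i = trans (cong (λ w → w + 2 * i ∸ 1) (*-suc 2 J)) (cong suc (+-comm (2 * J) (2 * i)))

index-left₁ : ∀ n J i → 2 * i ≤ n → n + 2 * suc J ∸ (2 * i + 1) ∸ 1 ≡ (n ∸ 2 * i) + 2 * J
index-left₁ n J i 2i≤n = begin
  n + 2 * suc J ∸ (2 * i + 1) ∸ 1
    ≡⟨ cong (λ w → w + 2 * suc J ∸ (2 * i + 1) ∸ 1) (sym (m∸n+n≡m 2i≤n)) ⟩
  (n ∸ 2 * i) + 2 * i + 2 * suc J ∸ (2 * i + 1) ∸ 1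
    ≡⟨ cong (λ w → w ∸ (2 * i + 1) ∸ 1) (shuffle (n ∸ 2 * i) i J) ⟩
  (2 * i + 1) + suc (n ∸ 2 * i + 2 * J) ∸ (2 * i + 1) ∸ 1
    ≡⟨ cong (_∸ 1) (m+n∸m≡n (2 * i + 1) _) ⟩
  (n ∸ 2 * i) + 2 * J
    ∎
  where
  open ≡-Reasoning
  shuffle : ∀ a i J → a + 2 * i + 2 * suc J ≡ (2 * i + 1) + suc (a + 2 * J)
  shuffle = solve-∀

index-left₂ : ∀ n J i → 2 * i ≤ n → n + 2 * suc J ∸ 2 * i ∸ 1 ≡ (suc n ∸ 2 * i) + 2 * J
index-left₂ n J i 2i≤n = begin
  n + 2 * suc J ∸ 2 * i ∸ 1
    ≡⟨ cong (λ w → w + 2 * suc J ∸ 2 * i ∸ 1) (sym (m∸n+n≡m 2i≤n)) ⟩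
  (n ∸ 2 * i) + 2 * i + 2 * suc J ∸ 2 * i ∸ 1
    ≡⟨ cong (λ w → w ∸ 2 * i ∸ 1) (shuffle (n ∸ 2 * i) i J) ⟩
  2 * i + suc (suc (n ∸ 2 * i + 2 * J)) ∸ 2 * i ∸ 1
    ≡⟨ cong (_∸ 1) (m+n∸m≡n (2 * i) _) ⟩
  suc (n ∸ 2 * i) + 2 * J
    ≡⟨ cong (_+ 2 * J) (+-∸-assoc 1 2i≤n) ⟨
  (suc n ∸ 2 * i) + 2 * J
    ∎
  where
  open ≡-Reasoning
  shuffle : ∀ a i J → a + 2 * i + 2 * suc J ≡ 2 * i + suc (suc (a + 2 * J))
  shuffle = solve-∀

Agrees : Maybe Bool → Bool → Set
Agrees (just b) c = c ≡ b
Agrees nothing  _ = ⊤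

module Fitting (k : ℕ) where

  open Rotation (N k) public

  -- J : Fin (2k+1) stands for the paper's j = J+1; offset r of P_{J+1} is the position r ⊕ 2J.
  record Fits (x : Fin (N k) → Bool) (J : Fin (suc (2 * k))) : Set where
    constructor fits
    field agrees : ∀ r → Agrees (role k (toℕ r)) (x (r ⊕ 2 * toℕ J))
  open Fits public

  fits-at : ∀ {x J} → Fits x J → ∀ r {b} → role k (toℕ r) ≡ just b → x (r ⊕ 2 * toℕ J) ≡ b
  fits-at {x} {J} x-fits r role≡ = subst (λ ρ → Agrees ρ (x (r ⊕ 2 * toℕ J))) role≡ (agrees x-fits r)

  at≡⊕ : ∀ P r d → P ∸ 1 ≡ toℕ r + d → at k P ≡ r ⊕ d
  at≡⊕ P r d eq = toℕ-injective (trans (toℕ-fromℕ< _) (trans (cong (_% N k) eq) (sym (toℕ-⊕ r d))))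

  Pattern⇒Fits : ∀ {x} J → Pattern k x (suc (toℕ J)) → Fits x J
  Pattern⇒Fits {x} J (x₁ , x₂ , x-rest) = fits λ r → agree-at r refl (offset-view k (toℕ<n r))
    where
    forced : ∀ {t b} P r → toℕ r ≡ t → P ∸ 1 ≡ t + 2 * toℕ J → x (at k P) ≡ b → x (r ⊕ 2 * toℕ J) ≡ b
    forced {b = b} P r refl idx xP = subst (λ q → x q ≡ b) (at≡⊕ P r (2 * toℕ J) idx) xP

    agree-at : ∀ {t} r → toℕ r ≡ t → Offset k t → Agrees (role k t) (x (r ⊕ 2 * toℕ J))
    agree-at r eq lead₁ = forced (2 * suc (toℕ J) ∸ 1) r eq (index-lead₁ (toℕ J)) x₁
    agree-at r eq lead₂ = forced (2 * suc (toℕ J)) r eq (index-lead₂ (toℕ J)) x₂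
    agree-at r eq (gap 1≤i i≤k) rewrite role-even 1≤i i≤k = tt
    agree-at r eq (right {i} 1≤i i≤k) rewrite role-odd k 1≤i =
      forced (2 * suc (toℕ J) + 2 * i) r eq (index-right (toℕ J) i) (proj₁ (x-rest i 1≤i i≤k))
    agree-at r eq (left₁ {i} 1≤i i≤k) rewrite role-left₁ i≤k =
      forced (N k + 2 * suc (toℕ J) ∸ (2 * i + 1)) r eq (index-left₁ (N k) (toℕ J) i (2i≤N i≤k))
        (proj₁ (proj₂ (x-rest i 1≤i i≤k)))
    agree-at r eq (left₂ {i} 1≤i i≤k) rewrite role-left₂ i≤k =
      forced (N k + 2 * suc (toℕ J) ∸ 2 * i) r eq (index-left₂ (N k) (toℕ J) i (2i≤N i≤k))
        (proj₂ (proj₂ (x-rest i 1≤i i≤k)))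

  Fits⇒Pattern : ∀ {x} J → Fits x J → Pattern k x (suc (toℕ J))
  Fits⇒Pattern {x} J x-fits =
    forced (2 * suc (toℕ J) ∸ 1) 0 (s≤s z≤n) (index-lead₁ (toℕ J)) refl ,
    forced (2 * suc (toℕ J)) 1 (1+2i<N {k} z≤n) (index-lead₂ (toℕ J)) refl ,
    λ i 1≤i i≤k →
      forced (2 * suc (toℕ J) + 2 * i) _ (1+2i<N i≤k) (index-right (toℕ J) i) (role-odd k 1≤i) ,
      forced (N k + 2 * suc (toℕ J) ∸ (2 * i + 1)) _ (N∸2i<N 1≤i i≤k)
        (index-left₁ (N k) (toℕ J) i (2i≤N i≤k)) (role-left₁ i≤k) ,
      forced (N k + 2 * suc (toℕ J) ∸ 2 * i) _ (1+N∸2i<N 1≤i i≤k)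
        (index-left₂ (N k) (toℕ J) i (2i≤N i≤k)) (role-left₂ i≤k)
    where
    forced : ∀ {b} P t (t<N : t < N k) → P ∸ 1 ≡ t + 2 * toℕ J → role k t ≡ just b → x (at k P) ≡ b
    forced {b} P t t<N idx role≡ =
      subst (λ q → x q ≡ b)
        (sym (at≡⊕ P (fromℕ< t<N) (2 * toℕ J) (trans idx (cong (_+ 2 * toℕ J) (sym (toℕ-fromℕ< t<N))))))
        (fits-at x-fits (fromℕ< t<N) (trans (cong (role k) (toℕ-fromℕ< t<N)) role≡))

  pattern⇔fits : ∀ {x} → (∃ λ j → 1 ≤ j × j ≤ 2 * k + 1 × Pattern k x j) ⇔ ∃ (Fits x)
  pattern⇔fits {x} = mk⇔ to from
    where
    to : (∃ λ j → 1 ≤ j × j ≤ 2 * k + 1 × Pattern k x j) → ∃ (Fits x)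
    to (suc j , _ , j<2k+1 , x-pattern) =
      fromℕ< j<m , Pattern⇒Fits (fromℕ< j<m) (subst (Pattern k x ∘ suc) (sym (toℕ-fromℕ< j<m)) x-pattern)
      where
      j<m : j < suc (2 * k)
      j<m = subst (suc j ≤_) (+-comm (2 * k) 1) j<2k+1
    from : ∃ (Fits x) → ∃ λ j → 1 ≤ j × j ≤ 2 * k + 1 × Pattern k x j
    from (J , x-fits) =
      suc (toℕ J) , s≤s z≤n , subst (suc (toℕ J) ≤_) (+-comm 1 (2 * k)) (toℕ<n J) , Fits⇒Pattern J x-fits

  fits-pointwise : ∀ {x y z J} → (∀ q → x q ≡ y q ⊎ x q ≡ z q) → Fits y J → Fits z J → Fits x J
  fits-pointwise {J = J} x≗y∪z y-fits z-fits = fits λ r →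
    [ (λ eq → subst (Agrees _) (sym eq) (agrees y-fits r))
    , (λ eq → subst (Agrees _) (sym eq) (agrees z-fits r))
    ] (x≗y∪z (r ⊕ 2 * toℕ J))

  fits-cong : ∀ {x y J} → (∀ q → x q ≡ y q) → Fits y J → Fits x J
  fits-cong x≗y y-fits = fits-pointwise (inj₁ ∘ x≗y) y-fits y-fits

  2J≤N : ∀ (J : Fin (suc (2 * k))) → 2 * toℕ J ≤ N k
  2J≤N J = *-monoʳ-≤ 2 (<⇒≤ (toℕ<n J))

  fits-flip-free : ∀ {x J r} → role k (toℕ r) ≡ nothing → Fits x J → Fits (flipBit x (r ⊕ 2 * toℕ J)) J
  fits-flip-free {x} {J} {r} free x-fits = fits agree
    where
    agree : ∀ r′ → Agrees (role k (toℕ r′)) (flipBit x (r ⊕ 2 * toℕ J) (r′ ⊕ 2 * toℕ J))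
    agree r′ with r′ ≟ r
    ... | yes refl = subst (λ ρ → Agrees ρ (flipBit x (r ⊕ 2 * toℕ J) (r ⊕ 2 * toℕ J))) (sym free) tt
    ... | no  r′≢r =
      subst (Agrees _) (sym (flipBit-other x (r′≢r ∘ ⊕-cancelʳ {r′} {r} (2J≤N J)))) (agrees x-fits r′)

  r₀ r₁ : Fin (N k)
  r₀ = Fin.zero
  r₁ = fromℕ< (1+2i<N {k} {0} z≤n)

  toℕ-r₁ : toℕ r₁ ≡ 1
  toℕ-r₁ = toℕ-fromℕ< (1+2i<N {k} {0} z≤n)

  r₁≤1 : toℕ r₁ ≤ 1
  r₁≤1 = ≤-reflexive toℕ-r₁

  role-r₁ : role k (toℕ r₁) ≡ just true
  role-r₁ = cong (role k) toℕ-r₁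

  toℕ-r⊕2i : ∀ {r i} → toℕ r ≤ 1 → i ≤ 2 * k → toℕ (r ⊕ 2 * i) ≡ toℕ r + 2 * i
  toℕ-r⊕2i {r} {i} r≤1 i≤2k =
    toℕ-⊕-< r (2 * i) (≤-<-trans (+-mono-≤ r≤1 (*-monoʳ-≤ 2 i≤2k)) (1+4k<N {k}))

  lead-injective : ∀ {r r′ J J′} → toℕ r ≤ 1 → toℕ r′ ≤ 1 →
                   r ⊕ 2 * toℕ J ≡ r′ ⊕ 2 * toℕ J′ → r ≡ r′ × J ≡ J′
  lead-injective {r} {r′} {J} {J′} r≤1 r′≤1 eq
    with r≡r′ , J≡J′ ← parity-cancel r≤1 r′≤1
           (trans (sym (toℕ-r⊕2i r≤1 (≤-pred (toℕ<n J))))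
                  (trans (cong toℕ eq) (toℕ-r⊕2i r′≤1 (≤-pred (toℕ<n J′)))))
    = toℕ-injective r≡r′ , toℕ-injective J≡J′

  first≢second : ∀ {J J′} → r₀ ⊕ 2 * toℕ J ≢ r₁ ⊕ 2 * toℕ J′
  first≢second {J} {J′} eq =
    contradiction (trans (cong toℕ (proj₁ (lead-injective {r₀} {r₁} {J} {J′} z≤n r₁≤1 eq))) toℕ-r₁) λ ()

  ⊕-shift : ∀ r d e f → (d + e) % N k ≡ f % N k → r ⊕ d ⊕ e ≡ r ⊕ f
  ⊕-shift r d e f eq = trans (⊕-assoc r d e) (⊕-cong-% r eq)

  fits-at-distance : ∀ {y J c q} r i → Fits y J → toℕ r ≤ 1 → i ≤ 2 * k →
                     r ⊕ 2 * i ⊕ 2 * toℕ J ≡ q → role k (toℕ r + 2 * i) ≡ just c → y q ≡ c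
  fits-at-distance {y} {c = c} r i y-fits r≤1 i≤2k shift role≡ =
    subst (λ q → y q ≡ c) shift (fits-at y-fits (r ⊕ 2 * i) (trans (cong (role k) (toℕ-r⊕2i r≤1 i≤2k)) role≡))

  one-at-even-offset⇒≤k : ∀ {y J q} i → Fits y J → i ≤ 2 * k →
                          r₀ ⊕ 2 * i ⊕ 2 * toℕ J ≡ q → y q ≡ true → i ≤ k
  one-at-even-offset⇒≤k i y-fits i≤2k shift yq with k <? i
  ... | no  k≮i = ≮⇒≥ k≮i
  ... | yes k<i = contradiction
    (trans (sym yq) (fits-at-distance r₀ i y-fits z≤n i≤2k shift (role-≥ k (2 * i) 2k+2≤2i))) λ ()
    where
    2k+2≤2i : 2 * k + 2 ≤ 2 * i
    2k+2≤2i = subst (_≤ 2 * i) (*-distribˡ-+ 2 k 1) (*-monoʳ-≤ 2 (subst (_≤ i) (+-comm 1 k) k<i))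

  template : Fin (suc (2 * k)) → Fin (N k) → Bool
  template J q = fromMaybe false (role k (toℕ (q ⊕ (N k ∸ 2 * toℕ J))))

  template-fits : ∀ J → Fits (template J) J
  template-fits J = fits λ r →
    subst (λ q → Agrees (role k (toℕ r)) (fromMaybe false (role k (toℕ q))))
      (sym (⊕-inverse (m+[n∸m]≡n (2J≤N J)) r)) (agrees-fromMaybe (role k (toℕ r)))
    where
    agrees-fromMaybe : ∀ ρ → Agrees ρ (fromMaybe false ρ)
    agrees-fromMaybe (just _) = refl
    agrees-fromMaybe nothing  = tt

  template-true : ∀ {J q} → template J q ≡ true → Σ (Fin (N k)) λ r → toℕ r ≤ 1 × q ≡ r ⊕ 2 * toℕ J
  template-true {J} {q} eq =
    q ⊕ (N k ∸ 2 * toℕ J) , fromMaybe-role≡true⇒≤1 k _ eq , sym (⊕-inverse (m∸n+n≡m (2J≤N J)) q)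

  template-lead : ∀ {J J′ r} → J′ ≢ J → toℕ r ≤ 1 → template J (r ⊕ 2 * toℕ J′) ≡ false
  template-lead {J} {J′} {r} J′≢J r≤1 with template J (r ⊕ 2 * toℕ J′) in eq
  ... | false = refl
  ... | true with r′ , r′≤1 , r⊕2J′≡r′⊕2J ← template-true {J} eq =
    contradiction (proj₂ (lead-injective r≤1 r′≤1 r⊕2J′≡r′⊕2J)) J′≢J

  constrained : Fin (N k) → Bool
  constrained r = is-just (role k (toℕ r))

  ∣constrained∣ : ∀ (J : Fin (suc (2 * k))) →
                  ∣ tabulate (λ q → constrained (q ⊕ (N k ∸ 2 * toℕ J))) ∣ ≡ 3 * k + 2
  ∣constrained∣ J = begin
    ∣ tabulate (λ q → constrained (q ⊕ (N k ∸ 2 * toℕ J))) ∣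
      ≡⟨ ∣tabulate∘permute∣ constrained (rotation (m∸n≤m (N k) (2 * toℕ J))) ⟩
    ∣ tabulate constrained ∣ ≡⟨ ∣tabulate∣≡sum constrained ⟩
    constrainedBelow (role k) (N k) ≡⟨ constrainedBelow-role k ⟩
    3 * k + 2 ∎
    where open ≡-Reasoning

module Sensitivity (k : ℕ) (g : BoolFun (N k)) (g-spec : ∀ x → (g x ≡ true) ⇔ ∃ (Fitting.Fits k x)) where

  open Fitting k

  g-true : ∀ {x J} → Fits x J → g x ≡ true
  g-true {x} {J} x-fits = Equivalence.from (g-spec x) (J , x-fits)

  g-true⇒fits : ∀ {x} → g x ≡ true → ∃ (Fits x)
  g-true⇒fits {x} = Equivalence.to (g-spec x)

  g-false : ∀ {x} → (∀ J → ¬ Fits x J) → g x ≡ false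
  g-false {x} no-fit with g x in gx
  ... | false = refl
  ... | true  = contradiction (proj₂ (g-true⇒fits gx)) (no-fit _)

  g-false⇒¬fits : ∀ {x J} → g x ≡ false → ¬ Fits x J
  g-false⇒¬fits gx x-fits = contradiction (trans (sym (g-true x-fits)) gx) λ ()

  flip-free-stays-true : ∀ {x J q} → Fits x J → constrained (q ⊕ (N k ∸ 2 * toℕ J)) ≡ false →
                         g (flipBit x q) ≡ true
  flip-free-stays-true {x} {J} {q} x-fits free = g-true
    (subst (λ p → Fits (flipBit x p) J) (⊕-inverse {N k ∸ 2 * toℕ J} (m∸n+n≡m (2J≤N J)) q)
      (fits-flip-free {x} {J} {q ⊕ (N k ∸ 2 * toℕ J)} (is-just≡false free) x-fits))
    where
    is-just≡false : ∀ {ρ : Maybe Bool} → is-just ρ ≡ false → ρ ≡ nothing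
    is-just≡false {nothing} _ = refl

  sens₁-bound : ∀ {x} → g x ≡ true → sens g x ≤ 3 * k + 2
  sens₁-bound {x} gx with J , x-fits ← g-true⇒fits gx = begin
    sens g x                                                 ≤⟨ ∣tabulate∣-mono-≤ sensitive⇒constrained ⟩
    ∣ tabulate (λ q → constrained (q ⊕ (N k ∸ 2 * toℕ J))) ∣ ≡⟨ ∣constrained∣ J ⟩
    3 * k + 2                                                ∎
    where
    open ≤-Reasoning
    sensitive⇒constrained : ∀ q → g (flipBit x q) xor g x ≡ true → constrained (q ⊕ (N k ∸ 2 * toℕ J)) ≡ true
    sensitive⇒constrained q sensitive with constrained (q ⊕ (N k ∸ 2 * toℕ J)) in free
    ... | true  = refl
    ... | false = contradiction (trans (sym sensitive) (cong₂ _xor_ (flip-free-stays-true x-fits free) gx)) λ ()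

  template-flip-constrained : ∀ J r {b} → role k (toℕ r) ≡ just b → g (flipBit (template J) (r ⊕ 2 * toℕ J)) ≡ false
  template-flip-constrained J r {b} role≡ = g-false no-fit
    where
    p = r ⊕ 2 * toℕ J
    no-fit : ∀ J′ → ¬ Fits (flipBit (template J) p) J′
    no-fit J′ fits′ with J′ ≟ J
    ... | yes refl = not-¬ refl (begin
      b                        ≡⟨ fits-at fits′ r role≡ ⟨
      flipBit (template J) p p ≡⟨ flipBit-self (template J) p ⟩
      not (template J p)       ≡⟨ cong not (fits-at (template-fits J) r role≡) ⟩
      not b                    ∎)
      where open ≡-Reasoning
    ... | no J′≢J  = first≢second {J′} {J′}
                       (trans (lead-is-p r₀ z≤n refl) (sym (lead-is-p r₁ r₁≤1 role-r₁)))
      where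
      lead-is-p : ∀ r′ → toℕ r′ ≤ 1 → role k (toℕ r′) ≡ just true → r′ ⊕ 2 * toℕ J′ ≡ p
      lead-is-p r′ r′≤1 role′≡ =
        flipBit-true (template J) (template-lead {J} {J′} {r′} J′≢J r′≤1) (fits-at fits′ r′ role′≡)

  template-flip : ∀ J q → g (flipBit (template J) q) ≡ not (constrained (q ⊕ (N k ∸ 2 * toℕ J)))
  template-flip J q with role k (toℕ (q ⊕ (N k ∸ 2 * toℕ J))) in role≡
  ... | nothing = flip-free-stays-true (template-fits J) (cong is-just role≡)
  ... | just _  = subst (λ p → g (flipBit (template J) p) ≡ false)
                        (⊕-inverse {N k ∸ 2 * toℕ J} (m∸n+n≡m (2J≤N J)) q)
                        (template-flip-constrained J (q ⊕ (N k ∸ 2 * toℕ J)) role≡)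

  sens-template : ∀ J → sens g (template J) ≡ 3 * k + 2
  sens-template J = trans (cong ∣_∣ (tabulate-cong sensitive≡constrained)) (∣constrained∣ J)
    where
    sensitive≡constrained : ∀ q → g (flipBit (template J) q) xor g (template J) ≡ constrained (q ⊕ (N k ∸ 2 * toℕ J))
    sensitive≡constrained q = begin
      g (flipBit (template J) q) xor g (template J)   ≡⟨ cong (g (flipBit (template J) q) xor_) (g-true (template-fits J)) ⟩
      g (flipBit (template J) q) xor true             ≡⟨ xor-comm _ true ⟩
      not (g (flipBit (template J) q))                ≡⟨ cong not (template-flip J q) ⟩
      not (not (constrained (q ⊕ (N k ∸ 2 * toℕ J)))) ≡⟨ not-involutive _ ⟩
      constrained (q ⊕ (N k ∸ 2 * toℕ J))             ∎
      where open ≡-Reasoning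

  -- With A and B the first and second leads: each Bᵢ sits at an odd offset of the other pattern,
  -- hence is one of the flipped positions; so neither Aᵢ is flipped, and A₂ and A₁ are ones at
  -- the even offsets 2·forward and 2·backward, which cannot both be ≤ 2k as they add up to 4k+2.
  flips-to-two-patterns : ∀ {x p p′ J₁ J₂} → toℕ J₁ < toℕ J₂ →
                          Fits (flipBit x p) J₁ → Fits (flipBit x p′) J₂ → p ≢ p′ → ⊥
  flips-to-two-patterns {x} {p} {p′} {J₁} {J₂} J₁<J₂ fits₁ fits₂ p≢p′ =
    <⇒≱ (subst (k + k <_) (sym forward+backward) (s≤s (≤-reflexive (cong (k +_) (sym (+-identityʳ k))))))
        (+-mono-≤ forward≤k backward≤k)
    where
    open Distance (distance {k} J₁<J₂ (toℕ<n J₂))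
    a b : ℕ
    a = toℕ J₁
    b = toℕ J₂
    A₁ A₂ B₁ B₂ : Fin (N k)
    A₁ = r₀ ⊕ 2 * a
    A₂ = r₀ ⊕ 2 * b
    B₁ = r₁ ⊕ 2 * a
    B₂ = r₁ ⊕ 2 * b

    shift-forward : ∀ r → r ⊕ 2 * forward ⊕ 2 * a ≡ r ⊕ 2 * b
    shift-forward r = ⊕-shift r (2 * forward) (2 * a) (2 * b) (cong (_% N k) forward-shift)
    shift-backward : ∀ r → r ⊕ 2 * backward ⊕ 2 * b ≡ r ⊕ 2 * a
    shift-backward r = ⊕-shift r (2 * backward) (2 * b) (2 * a)
      (trans (cong (_% N k) backward-shift) ([m+n]%n≡m%n (2 * a) (N k)))
    forward≤2k : forward ≤ 2 * k
    forward≤2k = ≤-of-sum forward+backward 1≤backward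
    backward≤2k : backward ≤ 2 * k
    backward≤2k = ≤-of-sum (trans (+-comm backward forward) forward+backward) 1≤forward

    role-r₁+odd : ∀ {i} → 1 ≤ i → role k (toℕ r₁ + 2 * i) ≡ just false
    role-r₁+odd {i} 1≤i = trans (cong (λ t → role k (t + 2 * i)) toℕ-r₁) (role-odd k 1≤i)
    B₂-in-1 : flipBit x p B₂ ≡ false
    B₂-in-1 = fits-at-distance r₁ forward fits₁ r₁≤1 forward≤2k (shift-forward r₁) (role-r₁+odd 1≤forward)
    B₁-in-2 : flipBit x p′ B₁ ≡ false
    B₁-in-2 = fits-at-distance r₁ backward fits₂ r₁≤1 backward≤2k (shift-backward r₁) (role-r₁+odd 1≤backward)

    B₁-flipped : B₁ ≡ p ⊎ B₁ ≡ p′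
    B₁-flipped = flipBit-differs x λ eq →
      contradiction (trans (sym (fits-at fits₁ r₁ role-r₁)) (trans eq B₁-in-2)) λ ()
    B₂-flipped : B₂ ≡ p ⊎ B₂ ≡ p′
    B₂-flipped = flipBit-differs x λ eq →
      contradiction (trans (sym B₂-in-1) (trans eq (fits-at fits₂ r₁ role-r₁))) λ ()
    B₁≢B₂ : B₁ ≢ B₂
    B₁≢B₂ eq = <-irrefl (cong toℕ (proj₂ (lead-injective {r₁} {r₁} {J₁} {J₂} r₁≤1 r₁≤1 eq))) J₁<J₂

    flipped-are-B : (p ≡ B₁ ⊎ p ≡ B₂) × (p′ ≡ B₁ ⊎ p′ ≡ B₂)
    flipped-are-B = sort B₁-flipped B₂-flipped
      where
      sort : B₁ ≡ p ⊎ B₁ ≡ p′ → B₂ ≡ p ⊎ B₂ ≡ p′ → (p ≡ B₁ ⊎ p ≡ B₂) × (p′ ≡ B₁ ⊎ p′ ≡ B₂)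
      sort (inj₁ B₁≡p)  (inj₁ B₂≡p)  = contradiction (trans B₁≡p (sym B₂≡p)) B₁≢B₂
      sort (inj₂ B₁≡p′) (inj₂ B₂≡p′) = contradiction (trans B₁≡p′ (sym B₂≡p′)) B₁≢B₂
      sort (inj₁ B₁≡p)  (inj₂ B₂≡p′) = inj₁ (sym B₁≡p) , inj₂ (sym B₂≡p′)
      sort (inj₂ B₁≡p′) (inj₁ B₂≡p)  = inj₂ (sym B₂≡p) , inj₁ (sym B₁≡p′)

    first-unflipped : ∀ J → r₀ ⊕ 2 * toℕ J ≢ p × r₀ ⊕ 2 * toℕ J ≢ p′
    first-unflipped J = not-B (proj₁ flipped-are-B) , not-B (proj₂ flipped-are-B)
      where
      not-B : ∀ {q} → q ≡ B₁ ⊎ q ≡ B₂ → r₀ ⊕ 2 * toℕ J ≢ q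
      not-B (inj₁ q≡B₁) eq = first≢second {J} {J₁} (trans eq q≡B₁)
      not-B (inj₂ q≡B₂) eq = first≢second {J} {J₂} (trans eq q≡B₂)

    A₂-in-1 : flipBit x p A₂ ≡ true
    A₂-in-1 = trans (flipBit-other x (proj₁ (first-unflipped J₂)))
                (trans (sym (flipBit-other x (proj₂ (first-unflipped J₂)))) (fits-at fits₂ r₀ refl))
    A₁-in-2 : flipBit x p′ A₁ ≡ true
    A₁-in-2 = trans (flipBit-other x (proj₂ (first-unflipped J₁)))
                (trans (sym (flipBit-other x (proj₁ (first-unflipped J₁)))) (fits-at fits₁ r₀ refl))

    forward≤k : forward ≤ k
    forward≤k = one-at-even-offset⇒≤k forward fits₁ forward≤2k (shift-forward r₀) A₂-in-1
    backward≤k : backward ≤ k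
    backward≤k = one-at-even-offset⇒≤k backward fits₂ backward≤2k (shift-backward r₀) A₁-in-2

  sensitive-unique : ∀ {x p p′} → g x ≡ false → g (flipBit x p) ≡ true → g (flipBit x p′) ≡ true → p ≡ p′
  sensitive-unique {x} {p} {p′} gx gp gp′ with p ≟ p′
  ... | yes p≡p′ = p≡p′
  ... | no  p≢p′
    with J₁ , fits₁ ← g-true⇒fits gp | J₂ , fits₂ ← g-true⇒fits gp′ | <-cmp (toℕ J₁) (toℕ J₂)
  ... | tri< J₁<J₂ _ _ = ⊥-elim (flips-to-two-patterns J₁<J₂ fits₁ fits₂ p≢p′)
  ... | tri> _ _ J₂<J₁ = ⊥-elim (flips-to-two-patterns J₂<J₁ fits₂ fits₁ (p≢p′ ∘ sym))
  ... | tri≈ _ J₁≡J₂ _ = ⊥-elim (g-false⇒¬fits gx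
          (fits-pointwise (flipBit-either x p≢p′) fits₁ (subst (Fits _) (sym (toℕ-injective J₁≡J₂)) fits₂)))

  sens-at-false : ∀ {x} → g x ≡ false → sens g x ≡ ∣ tabulate (λ q → g (flipBit x q)) ∣
  sens-at-false {x} gx =
    cong ∣_∣ (tabulate-cong λ q → trans (cong (g (flipBit x q) xor_) gx) (xor-identityʳ (g (flipBit x q))))

  sens₀-bound : ∀ {x} → g x ≡ false → sens g x ≤ 1
  sens₀-bound {x} gx =
    subst (_≤ 1) (sym (sens-at-false gx)) (∣tabulate∣≤1 {f = λ q → g (flipBit x q)} λ _ _ → sensitive-unique gx)

  template-flip-first : ∀ J → g (flipBit (template J) (r₀ ⊕ 2 * toℕ J)) ≡ false
  template-flip-first J = template-flip-constrained J r₀ refl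

  sens-template-flip-first : ∀ J → sens g (flipBit (template J) (r₀ ⊕ 2 * toℕ J)) ≡ 1
  sens-template-flip-first J = trans (sens-at-false (template-flip-first J))
    (∣tabulate∣≡1 {f = λ q → g (flipBit x q)} p
      (g-true {J = J} (fits-cong {J = J} (flipBit-involutive (template J) p) (template-fits J)))
      λ _ _ → sensitive-unique (template-flip-first J))
    where
    p = r₀ ⊕ 2 * toℕ J
    x = flipBit (template J) p

  all-false : Fin (N k) → Bool
  all-false _ = false

  g-all-false : g all-false ≡ false
  g-all-false = g-false λ J all-false-fits → contradiction (fits-at all-false-fits r₀ refl) λ ()

  lead-blocks : HasBlocks g all-false (2 * k + 1)
  lead-blocks = subst (HasBlocks g all-false) (+-comm 1 (2 * k)) (lead-block , disjoint , sensitive)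
    where
    lead-block : Fin (suc (2 * k)) → Subset (N k)
    lead-block J = tabulate (template J)
    disjoint : ∀ J J′ → J ≢ J′ → ∀ q → q ∈ lead-block J → q ∈ lead-block J′ → ⊥
    disjoint J J′ J≢J′ q q∈J q∈J′
      with r , r≤1 , q≡r⊕2J ← template-true {J} (∈-tabulate⁻ {f = template J} q∈J)
         | r′ , r′≤1 , q≡r′⊕2J′ ← template-true {J′} (∈-tabulate⁻ {f = template J′} q∈J′)
      = J≢J′ (proj₂ (lead-injective {r} {r′} {J} {J′} r≤1 r′≤1 (trans (sym q≡r⊕2J) q≡r′⊕2J′)))
    sensitive : ∀ J → g (flipSet all-false (lead-block J)) ≢ g all-false
    sensitive J eq = contradiction (trans (sym (g-true {J = J} flipped-fits)) (trans eq g-all-false)) λ ()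
      where
      flipped-fits : Fits (flipSet all-false (lead-block J)) J
      flipped-fits = fits-cong (λ q → trans (xor-identityʳ _) (lookup∘tabulate (template J) q)) (template-fits J)

  disjoint-flips-fit-differently : ∀ {x B B′ J} → g x ≡ false → (∀ q → q ∈ B → q ∈ B′ → ⊥) →
                                   Fits (flipSet x B) J → Fits (flipSet x B′) J → ⊥
  disjoint-flips-fit-differently {x} {B} {B′} gx disjoint fits-B fits-B′ =
    g-false⇒¬fits gx (fits-pointwise unflipped-by-one fits-B fits-B′)
    where
    unflipped-by-one : ∀ q → x q ≡ flipSet x B q ⊎ x q ≡ flipSet x B′ q
    unflipped-by-one q with lookup B q in q∈B | lookup B′ q in q∈B′
    ... | false | _     = inj₁ refl
    ... | true  | false = inj₂ refl
    ... | true  | true  = ⊥-elim (disjoint q (lookup⇒[]= q B q∈B) (lookup⇒[]= q B′ q∈B′))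

  block-pattern : ∀ {x B} → g x ≡ false → g (flipSet x B) ≢ g x → ∃ (Fits (flipSet x B))
  block-pattern gx sensitive = g-true⇒fits (trans (¬-not sensitive) (cong not gx))

  bs₀-bound : ∀ {x c} → g x ≡ false → HasBlocks g x c → c ≤ 2 * k + 1
  bs₀-bound {x} {c} gx (B , disjoint , sensitive) with c ≤? 2 * k + 1
  ... | yes c≤2k+1 = c≤2k+1
  ... | no  c≰2k+1
    with i , j , i<j , same ← pigeonhole (subst (_< c) (+-comm (2 * k) 1) (≰⇒> c≰2k+1))
                                          (λ i → proj₁ (block-pattern {B = B i} gx (sensitive i)))
    = ⊥-elim (disjoint-flips-fit-differently gx (disjoint i j (λ i≡j → <-irrefl (cong toℕ i≡j) i<j))
               (proj₂ (block-pattern {B = B i} gx (sensitive i)))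
               (subst (Fits _) (sym same) (proj₂ (block-pattern {B = B j} gx (sensitive j)))))

proposition1 : (k : ℕ) → (g : BoolFun (N k)) →
    (∀ x → (g x ≡ true) ⇔ (∃ λ j → 1 ≤ j × j ≤ 2 * k + 1 × Pattern k x j)) →
    IsSensB true g (3 * k + 2) × IsSensB false g 1 × IsBlockSens0 g (2 * k + 1)
proposition1 k g hyp =
  ((template J₀ , g-true (template-fits J₀) , sens-template J₀) ,
   λ { _ (_ , gx , refl) → sens₁-bound gx }) ,
  ((flipBit (template J₀) (r₀ ⊕ 2 * toℕ J₀) , template-flip-first J₀ , sens-template-flip-first J₀) ,
   λ { _ (_ , gx , refl) → sens₀-bound gx }) ,
  ((all-false , g-all-false , lead-blocks , λ _ → bs₀-bound g-all-false) ,
   λ { _ (_ , gx , blocks , _) → bs₀-bound gx blocks })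
  where
  open Fitting k
  open Sensitivity k g (λ x → ⇔-trans (hyp x) pattern⇔fits)
  J₀ : Fin (suc (2 * k))
  J₀ = Fin.zero
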